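{- Let $r \ge 3$ and $n \ge 1$ be integers. Then: (a) $g^{\mathrm{ns}}_r(n) \le g^{\mathrm{ff}}_r(n) \le (r-1)\, 2^{\lceil \frac{(r-2)n}{r-1} \rceil}$. (b) There exist positive constants $c^{\mathrm{ns}}_r$ and $c^{\mathrm{ff}}_r$, depending only on $r$, such that for all $n$, \[ g^{\mathrm{ns}}_r(n) \ge c^{\mathrm{ns}}_r \Big(\frac{2}{(r+1)^{\frac{1}{r-1}}}\Big)^n, \qquad g^{\mathrm{ff}}_r(n) \ge c^{\mathrm{ff}}_r \Big(\frac{2}{r^{\frac{1}{r-1}}}\Big)^n. \]
   Context: Vectors in $\{0,1\}^n$ are identified with subsets of $[n]=\{1,\dots,n\}$. A family $\mathcal{H}$ of $r$ distinct subsets of $[n]$ is a near-sunflower of size $r$ if every $i \in [n]$ belongs to exactly $0$, $1$, $r-1$ or $r$ of the sets in $\mathcal{H}$. A family $x^{(0)}, x^{(1)},\ldots, x^{(r-1)}$ of $r$ distinct vectors in $\{0,1\}^n$ is focal with focus $x^{(0)}$ if for every coordinate $i \in [n]$, at least $r-2$ of the $r-1$ entries $x^{(1)}_i,\ldots,x^{(r-1)}_i$ are equal to $x^{(0)}_i$; a family contains a focal family of size $r$ if some $r$ distinct members, with some choice of focus among them, form a focal family. Define $g^{\mathrm{ns}}_r(n)$ as the maximum of $|\mathcal{F}|$ over $\mathcal{F} \subseteq \{0,1\}^n$ containing no near-sunflower of size $r$, and $g^{\mathrm{ff}}_r(n)$ as the maximum of $|\mathcal{F}|$ over $\mathcal{F}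 \subseteq \{0,1\}^n$ containing no focal family of size $r$. -}

module Defs where

open import Data.Nat using (ℕ; zero; suc; _+_; _*_; _∸_; _≤_; _/_)
open import Data.Bool using (Bool; true; false; if_then_else_)
open import Data.Vec using (Vec; lookup)
open import Data.Fin using (Fin)
open import Data.List using (List; []; _∷_; length; map)
open import Data.Nat.ListAction using (sum)
open import Data.List.Relation.Unary.All using (All)
open import Data.List.Relation.Unary.Unique.Propositional using (Unique)
open import Data.List.Membership.Propositional using (_∈_)
open import Data.Product using (Σ; _×_; ∃)
open import Data.Sum using (_⊎_)
open import Relation.Binary.PropositionalEquality using (_≡_)
open import Relation.Nullary using (¬_)

-- A vector of {0,1}^n, identified with a subset of [n] (true = 1 = "i belongs").
BVec : ℕ → Set
BVec n = Vec Bool n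

-- A family of vectors: a list (distinctness is imposed separately via Unique).
Family : ℕ → Set
Family n = List (BVec n)

countIn : ∀ {n} → Fin n → Family n → ℕ
countIn i H = sum (map (λ x → if lookup x i then 1 else 0) H)

countEq : ∀ {n} → Fin n → Bool → Family n → ℕ
countEq i b xs = sum (map (λ x → if eqB (lookup x i) b then 1 else 0) xs)
  where
  eqB : Bool → Bool → Bool
  eqB true true = true
  eqB false false = true
  eqB _ _ = false

NearSunflower : ∀ {n} → ℕ → Family n → Set
NearSunflower {n} r H =
  Unique H × length H ≡ r ×
  ((i : Fin n) → countIn i H ≡ 0 ⊎ countIn i H ≡ 1 ⊎ countIn i H ≡ r ∸ 1 ⊎ countIn i H ≡ r)

Focal : ∀ {n} → ℕ → BVec n → Family n → Set
Focal {n} r x0 xs =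
  Unique (x0 ∷ xs) × length (x0 ∷ xs) ≡ r ×
  ((i : Fin n) → r ∸ 2 ≤ countEq i (lookup x0 i) xs)

_⊆F_ : ∀ {n} → Family n → Family n → Set
H ⊆F F = All (_∈ F) H

ContainsNearSunflower : ∀ {n} → ℕ → Family n → Set
ContainsNearSunflower r F = ∃ λ H → H ⊆F F × NearSunflower r H

ContainsFocal : ∀ {n} → ℕ → Family n → Set
ContainsFocal {n} r F =
  Σ (BVec n) λ x0 → Σ (Family n) λ xs → (x0 ∷ xs) ⊆F F × Focal r x0 xs

NSFree : ∀ n → ℕ → Family n → Set
NSFree n r F = Unique F × ¬ ContainsNearSunflower r F

FFFree : ∀ n → ℕ → Family n → Set
FFFree n r F = Unique F × ¬ ContainsFocal r F

IsMaxSize : ∀ {n} → (Family n → Set) → ℕ → Set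
IsMaxSize {n} P m =
  (Σ (Family n) λ F → P F × length F ≡ m) × ((F : Family n) → P F → length F ≤ m)

IsGns : ℕ → ℕ → ℕ → Set
IsGns r n m = IsMaxSize (NSFree n r) m

IsGff : ℕ → ℕ → ℕ → Set
IsGff r n m = IsMaxSize (FFFree n r) m

-- ceiling division ⌈ m / d ⌉ (d > 0); value 0 for d = 0 (unused).
ceilDiv : ℕ → ℕ → ℕ
ceilDiv m zero = 0
ceilDiv m (suc d) = (m + d) / suc d

{-# OPTIONS --safe #-}
module Submission where

-- Both notions are read off the columns of the r × n matrix of a configuration: a near-sunflower
-- is a family of r distinct vectors each of whose columns deviates in at most one entry from a
-- constant column, and a focal family is one where every column deviates in at most one entry
-- from the entry of the focus. In particular every focal family is a near-sunflower.
--
-- Upper bound: split the coordinates into the R = r - 1 residue classes modulo R. If some x in a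
-- focal-free F had, for every class j, another member of F agreeing with x outside class j, then
-- x and these R vectors would form a focal family with focus x. So every member of F is isolated
-- in some class j, and the members isolated in class j are determined by their at most
-- ⌈(r - 2) n / (r - 1)⌉ coordinates outside class j.
--
-- Lower bounds, by the deletion method: keep each vector of {0,1}^n with probability 1/M and then
-- delete one vector of each surviving configuration. All columns of a configuration lie in a fixed
-- set of 2K columns (K = r + 1 for near-sunflowers, K = r for focal families), so there are at
-- most (2K)^n configurations, each surviving with probability M^-r; taking M^(r-1) ≈ 2 K^n leaves
-- about 2^n / M vectors. Probabilities become weighted sums over all subfamilies, and an averaging
-- argument picks a good subfamily.

open import Defs
open import Data.Bool using (Bool; true; false; not; _∧_; _xor_; if_then_else_; T)
import Data.Bool.Properties as Bool
open import Data.Bool.ListAction using (all)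
open import Data.Empty using (⊥)
open import Data.Fin using (Fin; toℕ) renaming (zero to fzero; suc to fsuc)
open import Data.Fin.Properties using (toℕ<n; toℕ-injective; ¬∀⟶∃¬; all?; any?)
import Data.List as List
open import Data.List
  using (List; []; _∷_; length; map; _++_; zipWith; cartesianProductWith; filter; filterᵇ; tabulate)
open import Data.List.Membership.Propositional using (_∈_; find; lose)
open import Data.List.Membership.Propositional.Properties
  using (∈-cartesianProductWith⁺; ∈-filter⁺; ∈-filter⁻; ∈-map⁺; ∈-map⁻; ∈-++⁺ˡ; ∈-++⁺ʳ; ∈-++⁻)
open import Data.List.Properties using (length-map; length-++; length-tabulate; length-filter; map-tabulate)
open import Data.List.Relation.Unary.All using (All; []; _∷_)
import Data.List.Relation.Unary.All as All
import Data.List.Relation.Unary.All.Properties as All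
open import Data.List.Relation.Unary.AllPairs using (AllPairs; []; _∷_)
import Data.List.Relation.Unary.AllPairs as AllPairs
import Data.List.Relation.Unary.AllPairs.Properties as AllPairs
open import Data.List.Relation.Unary.Any using (Any; here; there)
import Data.List.Relation.Unary.Any as Any
open import Data.List.Relation.Unary.Unique.Propositional using (Unique)
import Data.List.Relation.Unary.Unique.Propositional.Properties as Unique
open import Data.Nat
  using (ℕ; zero; suc; _+_; _*_; _∸_; _^_; _≤_; _<_; z≤n; s≤s; z<s; _≟_; _≤?_; pred; NonZero; >-nonZero; >-nonZero⁻¹)
open import Data.Nat.DivMod
  using (_/_; _%_; m≡m%n+[m/n]*n; m%n<n; [m+n]%n≡m%n; m<n⇒m%n≡m; m/n*n≤m; m*n/n≡m; /-monoˡ-≤)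
open import Data.Nat.Properties
open import Algebra.Properties.CommutativeMonoid.Sum +-0-commutativeMonoid
  using (sum; sum-syntax; sum-cong-≗; ∑-distrib-+; sum-remove)
open import Data.Nat.Solver using (module +-*-Solver)
open +-*-Solver using (solve; _:+_; _:*_; _:=_; con)
open import Data.Product using (∃; ∃₂; _×_; _,_; proj₁; proj₂)
open import Data.Sum using (_⊎_; inj₁; inj₂)
open import Data.Unit using (tt)
open import Data.Vec using ([]; _∷_; lookup; tail; replicate)
import Data.Vec.Properties as Vec
open import Function using (_∘′_; id)
open import Relation.Binary.PropositionalEquality
open import Relation.Nullary using (¬_; Dec; yes; no; contradiction; ¬?; _×-dec_; _→-dec_)
open import Relation.Nullary.Decidable
  using (T?; ⌊_⌋; does; dec-true; fromWitness; fromWitnessFalse; decidable-stable)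
open import Relation.Unary using (Decidable)

_≟ᵛ_ : ∀ {n} (x y : BVec n) → Dec (x ≡ y)
_≟ᵛ_ = Vec.≡-dec Bool._≟_

bit : Bool → ℕ
bit b = if b then 1 else 0

bit≤1 : ∀ b → bit b ≤ 1
bit≤1 true = ≤-refl
bit≤1 false = z≤n

T⇒bit≡1 : ∀ {b} → T b → bit b ≡ 1
T⇒bit≡1 {true} _ = refl

bit-∧ : ∀ a b → bit (a ∧ b) ≡ bit a * bit b
bit-∧ true b = sym (+-identityʳ (bit b))
bit-∧ false b = refl

-- Columns and near-constant columns

column : ∀ {n} → Fin n → Family n → List Bool
column i = map (λ x → lookup x i)

deviations : Bool → List Bool → ℕ
deviations b [] = 0
deviations b (c ∷ cs) = bit (c xor b) + deviations b cs

Near : Bool → List Bool → Set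
Near b c = deviations b c ≤ 1

NearConstant : List Bool → Set
NearConstant c = Near false c ⊎ Near true c

countIn≡deviations : ∀ {n} (i : Fin n) H → countIn i H ≡ deviations false (column i H)
countIn≡deviations i [] = refl
countIn≡deviations i (x ∷ H) with lookup x i
... | true = cong suc (countIn≡deviations i H)
... | false = countIn≡deviations i H

countIn+deviations≡length : ∀ {n} (i : Fin n) H → countIn i H + deviations true (column i H) ≡ length H
countIn+deviations≡length i [] = refl
countIn+deviations≡length i (x ∷ H) with lookup x i
... | true = cong suc (countIn+deviations≡length i H)
... | false = trans (+-suc _ _) (cong suc (countIn+deviations≡length i H))

countEq+deviations≡length : ∀ {n} (i : Fin n) b xs → countEq i b xs + deviations b (column i xs) ≡ length xs
countEq+deviations≡length i b [] = refl
countEq+deviations≡length i b (x ∷ xs) with lookup x i | b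
... | true | true = cong suc (countEq+deviations≡length i true xs)
... | false | false = cong suc (countEq+deviations≡length i false xs)
... | true | false = trans (+-suc _ _) (cong suc (countEq+deviations≡length i false xs))
... | false | true = trans (+-suc _ _) (cong suc (countEq+deviations≡length i true xs))

≤1⇒∸1≤ : ∀ {a b c} → a + b ≡ c → b ≤ 1 → c ∸ 1 ≤ a
≤1⇒∸1≤ {a} refl z≤n = ≤-trans (m∸n≤m (a + 0) 1) (≤-reflexive (+-identityʳ a))
≤1⇒∸1≤ {a} refl (s≤s z≤n) = ≤-reflexive (m+n∸n≡m a 1)

∸1≤⇒≤1 : ∀ {a b c} → a + b ≡ c → c ∸ 1 ≤ a → b ≤ 1
∸1≤⇒≤1 {b = zero} _ _ = z≤n
∸1≤⇒≤1 {b = suc zero} _ _ = s≤s z≤n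
∸1≤⇒≤1 {a} {b = suc (suc b)} refl le =
  contradiction (subst (_≤ a) (cong (_∸ 1) (+-suc a (suc b))) le) (<⇒≱ (m<m+n a z<s))

SunflowerCount : ℕ → ℕ → Set
SunflowerCount r c = c ≡ 0 ⊎ c ≡ 1 ⊎ c ≡ r ∸ 1 ⊎ c ≡ r

sunflowerCount⇒ : ∀ {r c} → SunflowerCount r c → c ≤ 1 ⊎ r ∸ 1 ≤ c
sunflowerCount⇒ (inj₁ refl) = inj₁ z≤n
sunflowerCount⇒ (inj₂ (inj₁ refl)) = inj₁ (s≤s z≤n)
sunflowerCount⇒ (inj₂ (inj₂ (inj₁ refl))) = inj₂ ≤-refl
sunflowerCount⇒ {r} (inj₂ (inj₂ (inj₂ refl))) = inj₂ (m∸n≤m r 1)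

sunflowerCount⇐ : ∀ {r c} → c ≤ r → c ≤ 1 ⊎ r ∸ 1 ≤ c → SunflowerCount r c
sunflowerCount⇐ _ (inj₁ z≤n) = inj₁ refl
sunflowerCount⇐ _ (inj₁ (s≤s z≤n)) = inj₂ (inj₁ refl)
sunflowerCount⇐ {zero} z≤n (inj₂ _) = inj₁ refl
sunflowerCount⇐ {suc r} c≤r (inj₂ r≤c) with m≤n⇒m<n∨m≡n c≤r
... | inj₁ c<r = inj₂ (inj₂ (inj₁ (≤-antisym (≤-pred c<r) r≤c)))
... | inj₂ c≡r = inj₂ (inj₂ (inj₂ c≡r))

nearSunflower⇒nearConstant : ∀ {n r} {H : Family n} → NearSunflower r H → ∀ i → NearConstant (column i H)
nearSunflower⇒nearConstant {H = H} (_ , refl , counts) i with sunflowerCount⇒ (counts i)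
... | inj₁ c≤1 = inj₁ (subst (_≤ 1) (countIn≡deviations i H) c≤1)
... | inj₂ r∸1≤c = inj₂ (∸1≤⇒≤1 (countIn+deviations≡length i H) r∸1≤c)

nearConstant⇒nearSunflower : ∀ {n r} {H : Family n} → Unique H → length H ≡ r →
                             (∀ i → NearConstant (column i H)) → NearSunflower r H
nearConstant⇒nearSunflower {H = H} unique refl near = unique , refl , λ i →
  sunflowerCount⇐ (m+n≤o⇒m≤o _ (≤-reflexive (countIn+deviations≡length i H))) (ends i (near i))
  where
  ends : ∀ i → NearConstant (column i H) → countIn i H ≤ 1 ⊎ length H ∸ 1 ≤ countIn i H
  ends i (inj₁ near₀) = inj₁ (subst (_≤ 1) (sym (countIn≡deviations i H)) near₀)
  ends i (inj₂ near₁) = inj₂ (≤1⇒∸1≤ (countIn+deviations≡length i H) near₁)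

focal⇒near : ∀ {n r} {x₀ : BVec n} {xs} → Focal r x₀ xs → ∀ i → Near (lookup x₀ i) (column i xs)
focal⇒near {x₀ = x₀} {xs} (_ , refl , counts) i = ∸1≤⇒≤1 (countEq+deviations≡length i (lookup x₀ i) xs) (counts i)

near⇒focal : ∀ {n R} {x₀ : BVec n} {xs} → Unique (x₀ ∷ xs) → length xs ≡ R →
             (∀ i → Near (lookup x₀ i) (column i xs)) → Focal (suc R) x₀ xs
near⇒focal {x₀ = x₀} {xs} unique refl near =
  unique , refl , λ i → ≤1⇒∸1≤ (countEq+deviations≡length i (lookup x₀ i) xs) (near i)

near⇒nearConstant-∷ : ∀ b c → Near b c → NearConstant (b ∷ c)
near⇒nearConstant-∷ false c = inj₁
near⇒nearConstant-∷ true c = inj₂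

focal⇒nearSunflower : ∀ {n r} {x₀ : BVec n} {xs} → Focal r x₀ xs → NearSunflower r (x₀ ∷ xs)
focal⇒nearSunflower {x₀ = x₀} {xs} focal@(unique , length≡r , _) = nearConstant⇒nearSunflower unique length≡r
  λ i → near⇒nearConstant-∷ (lookup x₀ i) (column i xs) (focal⇒near focal i)

nsFree⇒ffFree : ∀ {n r} {F : Family n} → NSFree n r F → FFFree n r F
nsFree⇒ffFree (unique , noSunflower) =
  unique , λ (x₀ , xs , x₀∷xs⊆F , focal) → noSunflower (x₀ ∷ xs , x₀∷xs⊆F , focal⇒nearSunflower focal)

gns≤gff : ∀ {r n a b} → IsGns r n a → IsGff r n b → a ≤ b
gns≤gff ((F , free , refl) , _) (_ , maximal) = maximal F (nsFree⇒ffFree free)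

all≡⇒deviations≡0 : ∀ {b cs} → All (_≡ b) cs → deviations b cs ≡ 0
all≡⇒deviations≡0 [] = refl
all≡⇒deviations≡0 {b} (refl ∷ cs≡b) = cong₂ _+_ (cong bit (Bool.xor-same b)) (all≡⇒deviations≡0 cs≡b)

no-two-deviate⇒near : ∀ {b cs} → AllPairs (λ c c' → c ≡ b ⊎ c' ≡ b) cs → Near b cs
no-two-deviate⇒near [] = z≤n
no-two-deviate⇒near {b} {c ∷ cs} (first ∷ rest) with c Bool.≟ b
... | yes refl = subst (λ k → k + deviations b cs ≤ 1) (sym (cong bit (Bool.xor-same b))) (no-two-deviate⇒near rest)
... | no c≢b = subst (λ k → bit (c xor b) + k ≤ 1) (sym (all≡⇒deviations≡0 (All.map others first)))
                 (subst (_≤ 1) (sym (+-identityʳ _)) (bit≤1 (c xor b)))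
  where
  others : ∀ {c'} → c ≡ b ⊎ c' ≡ b → c' ≡ b
  others (inj₁ c≡b) = contradiction c≡b c≢b
  others (inj₂ c'≡b) = c'≡b

-- Focal-free families: the upper bound

slice : ∀ {n} → Bool → List (BVec (suc n)) → Family n
slice b [] = []
slice false ((false ∷ v) ∷ L) = v ∷ slice false L
slice false ((true ∷ v) ∷ L) = slice false L
slice true ((false ∷ v) ∷ L) = slice true L
slice true ((true ∷ v) ∷ L) = v ∷ slice true L

length-slices : ∀ {n} (L : List (BVec (suc n))) → length L ≡ length (slice false L) + length (slice true L)
length-slices [] = refl
length-slices ((false ∷ v) ∷ L) = cong suc (length-slices L)
length-slices ((true ∷ v) ∷ L) = trans (cong suc (length-slices L)) (sym (+-suc _ _))

module _ {n} {P : BVec (suc n) → Set} {Q : BVec n → Set} where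

  slice-all⁺ : ∀ b → (∀ {v} → P (b ∷ v) → Q v) → ∀ {L} → All P L → All Q (slice b L)
  slice-all⁺ b f {[]} [] = []
  slice-all⁺ false f {(false ∷ v) ∷ L} (p ∷ ps) = f p ∷ slice-all⁺ false f ps
  slice-all⁺ false f {(true ∷ v) ∷ L} (p ∷ ps) = slice-all⁺ false f ps
  slice-all⁺ true f {(false ∷ v) ∷ L} (p ∷ ps) = slice-all⁺ true f ps
  slice-all⁺ true f {(true ∷ v) ∷ L} (p ∷ ps) = f p ∷ slice-all⁺ true f ps

module _ {n} {R : BVec (suc n) → BVec (suc n) → Set} {S : BVec n → BVec n → Set} where

  slice-allPairs⁺ : ∀ b → (∀ {u v} → R (b ∷ u) (b ∷ v) → S u v) → ∀ {L} → AllPairs R L → AllPairs S (slice b L)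
  slice-allPairs⁺ b f {[]} [] = []
  slice-allPairs⁺ false f {(false ∷ v) ∷ L} (r ∷ rs) = slice-all⁺ false f r ∷ slice-allPairs⁺ false f rs
  slice-allPairs⁺ false f {(true ∷ v) ∷ L} (r ∷ rs) = slice-allPairs⁺ false f rs
  slice-allPairs⁺ true f {(false ∷ v) ∷ L} (r ∷ rs) = slice-allPairs⁺ true f rs
  slice-allPairs⁺ true f {(true ∷ v) ∷ L} (r ∷ rs) = slice-all⁺ true f r ∷ slice-allPairs⁺ true f rs

slice-unique⁺ : ∀ {n} b {L : List (BVec (suc n))} → Unique L → Unique (slice b L)
slice-unique⁺ b = slice-allPairs⁺ b λ b∷u≢b∷v u≡v → b∷u≢b∷v (cong (b ∷_) u≡v)

Agree : ∀ {n} → (ℕ → Bool) → BVec n → BVec n → Set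
Agree K x y = ∀ i → T (K (toℕ i)) → lookup x i ≡ lookup y i

agree? : ∀ {n} K (x y : BVec n) → Dec (Agree K x y)
agree? K x y = all? λ i → T? (K (toℕ i)) →-dec (lookup x i Bool.≟ lookup y i)

agree-∷ : ∀ {n K b b'} {u v : BVec n} → (T (K 0) → b ≡ b') → Agree (K ∘′ suc) u v → Agree K (b ∷ u) (b' ∷ v)
agree-∷ agree₀ _ fzero = agree₀
agree-∷ _ agreeₛ (fsuc i) = agreeₛ i

count : (ℕ → Bool) → ℕ → ℕ
count K zero = 0
count K (suc n) = bit (K 0) + count (K ∘′ suc) n

Separated : ∀ {n} → (ℕ → Bool) → Family n → Set
Separated K = AllPairs (λ x y → ¬ Agree K x y)

separated⇒length≤ : ∀ {n} K (L : Family n) → Separated K L → length L ≤ 2 ^ count K n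
separated⇒length≤ {zero} K [] _ = z≤n
separated⇒length≤ {zero} K (_ ∷ []) _ = s≤s z≤n
separated⇒length≤ {zero} K ([] ∷ [] ∷ _) ((disagree ∷ _) ∷ _) = contradiction (λ ()) disagree
separated⇒length≤ {suc n} K L separated with K 0 in K0
... | true = begin
  length L                                         ≡⟨ length-slices L ⟩
  length (slice false L) + length (slice true L)   ≤⟨ +-mono-≤ (half false) (half true) ⟩
  2 ^ c + 2 ^ c                                    ≡⟨ cong (2 ^ c +_) (sym (+-identityʳ (2 ^ c))) ⟩
  2 ^ suc c                                        ∎
  where
  open ≤-Reasoning
  c = count (K ∘′ suc) n
  half : ∀ b → length (slice b L) ≤ 2 ^ c
  half b = separated⇒length≤ (K ∘′ suc) (slice b L)
    (slice-allPairs⁺ b (λ disagree agree → disagree (agree-∷ {K = K} (λ _ → refl) agree)) separated)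
... | false = subst (_≤ 2 ^ count (K ∘′ suc) n) (length-map tail L)
  (separated⇒length≤ (K ∘′ suc) (map tail L) (AllPairs.map⁺ (AllPairs.map (λ {x} {y} → tails {x} {y}) separated)))
  where
  tails : ∀ {x y : BVec (suc n)} → ¬ Agree K x y → ¬ Agree (K ∘′ suc) (tail x) (tail y)
  tails {_ ∷ _} {_ ∷ _} disagree agree = disagree (agree-∷ {K = K} (λ k → contradiction (subst T K0 k) id) agree)

count-mono : ∀ K {a b} → a ≤ b → count K a ≤ count K b
count-mono K z≤n = z≤n
count-mono K (s≤s a≤b) = +-monoʳ-≤ (bit (K 0)) (count-mono (K ∘′ suc) a≤b)

count-+ : ∀ K a b → count K (a + b) ≡ count K a + count (λ i → K (a + i)) b
count-+ K zero b = refl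
count-+ K (suc a) b = trans (cong (bit (K 0) +_) (count-+ (K ∘′ suc) a b)) (sym (+-assoc (bit (K 0)) _ _))

count-cong : ∀ {K K'} n → (∀ i → K i ≡ K' i) → count K n ≡ count K' n
count-cong zero _ = refl
count-cong (suc n) K≗K' = cong₂ _+_ (cong bit (K≗K' 0)) (count-cong n (λ i → K≗K' (suc i)))

count+count-not : ∀ K n → count K n + count (not ∘′ K) n ≡ n
count+count-not K zero = refl
count+count-not K (suc n) with K 0
... | true = cong suc (count+count-not (K ∘′ suc) n)
... | false = trans (+-suc _ _) (cong suc (count+count-not (K ∘′ suc) n))

bit≤count : ∀ K {i n} → i < n → bit (K i) ≤ count K n
bit≤count K {zero} (s≤s _) = m≤m+n (bit (K 0)) _
bit≤count K {suc i} (s≤s i<n) = ≤-trans (bit≤count (K ∘′ suc) i<n) (m≤n+m _ (bit (K 0)))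

module ResidueClasses (d : ℕ) where

  R : ℕ
  R = suc d

  inClass : ℕ → ℕ → Bool
  inClass j i = ⌊ i % R ≟ j ⌋

  count-inClass≥ : ∀ {j} → j < R → ∀ n → n / R ≤ count (inClass j) n
  count-inClass≥ {j} j<R n = ≤-trans (blocks (n / R)) (count-mono (inClass j) (m/n*n≤m n R))
    where
    periodic : ∀ i → inClass j (R + i) ≡ inClass j i
    periodic i = cong (λ k → ⌊ k ≟ j ⌋) (trans (cong (_% R) (+-comm R i)) ([m+n]%n≡m%n i R))
    j∈class : bit (inClass j j) ≡ 1
    j∈class = T⇒bit≡1 (fromWitness (m<n⇒m%n≡m j<R))
    blocks : ∀ q → q ≤ count (inClass j) (q * R)
    blocks zero = z≤n
    blocks (suc q) = begin
      suc q
        ≤⟨ +-mono-≤ (subst (_≤ count (inClass j) R) j∈class (bit≤count (inClass j) j<R)) (blocks q) ⟩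
      count (inClass j) R + count (inClass j) (q * R)
        ≡⟨ cong (count (inClass j) R +_) (count-cong (q * R) periodic) ⟨
      count (inClass j) R + count (λ i → inClass j (R + i)) (q * R)
        ≡⟨ count-+ (inClass j) R (q * R) ⟨
      count (inClass j) (R + q * R) ∎
      where open ≤-Reasoning

  count-offClass≤ : ∀ {j} → j < R → ∀ n → count (not ∘′ inClass j) n ≤ (d * n + d) / R
  count-offClass≤ {j} j<R n = subst (_≤ (d * n + d) / R) (m*n/n≡m k R) (/-monoˡ-≤ R kR≤)
    where
    c = count (inClass j) n
    k = count (not ∘′ inClass j) n
    n≤d+cR : n ≤ d + c * R
    n≤d+cR = begin
      n                   ≡⟨ m≡m%n+[m/n]*n n R ⟩
      n % R + n / R * R   ≤⟨ +-mono-≤ (≤-pred (m%n<n n R)) (*-monoˡ-≤ R (count-inClass≥ j<R n)) ⟩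
      d + c * R           ∎
      where open ≤-Reasoning
    kR≤ : k * R ≤ d * n + d
    kR≤ = +-cancelˡ-≤ (c * R) _ _ (begin
      c * R + k * R       ≡⟨ *-distribʳ-+ R c k ⟨
      (c + k) * R         ≡⟨ cong (_* R) (count+count-not (inClass j) n) ⟩
      n * R               ≡⟨ *-suc n d ⟩
      n + n * d           ≤⟨ +-monoˡ-≤ (n * d) n≤d+cR ⟩
      d + c * R + n * d   ≡⟨ solve 4 (λ d c r n → d :+ c :* r :+ n :* d := c :* r :+ (d :* n :+ d)) refl d c R n ⟩
      c * R + (d * n + d) ∎)
      where open ≤-Reasoning

allPairs-map-with-∈ : ∀ {A : Set} {R S : A → A → Set} {xs} → AllPairs R xs →
                      (∀ {x y} → x ∈ xs → y ∈ xs → R x y → S x y) → AllPairs S xs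
allPairs-map-with-∈ [] _ = []
allPairs-map-with-∈ (r ∷ rs) f =
  All.tabulate (λ y∈xs → f (here refl) (there y∈xs) (All.lookup r y∈xs)) ∷
  allPairs-map-with-∈ rs (λ x∈ y∈ → f (there x∈) (there y∈))

≢⇒∃lookup≢ : ∀ {n} {x y : BVec n} → x ≢ y → ∃ λ i → lookup x i ≢ lookup y i
≢⇒∃lookup≢ {n} {x} {y} x≢y = ¬∀⟶∃¬ n _ (λ i → lookup x i Bool.≟ lookup y i)
  λ pointwise → x≢y (trans (sym (Vec.tabulate∘lookup x)) (trans (Vec.tabulate-cong pointwise) (Vec.tabulate∘lookup y)))

length-filter-∷ : ∀ {A : Set} {P : A → Set} (P? : Decidable P) x xs →
                  length (filter P? (x ∷ xs)) ≡ bit (does (P? x)) + length (filter P? xs)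
length-filter-∷ P? x xs with does (P? x)
... | true = refl
... | false = refl

∑-bound : ∀ {k c} (f : Fin k → ℕ) → (∀ j → f j ≤ c) → ∑[ j < k ] f j ≤ k * c
∑-bound {zero} f _ = z≤n
∑-bound {suc k} f f≤c = +-mono-≤ (f≤c fzero) (∑-bound (f ∘′ fsuc) (λ j → f≤c (fsuc j)))

length≤∑filter : ∀ {A : Set} {k} {P : Fin k → A → Set} (P? : ∀ j → Decidable (P j)) xs →
                 All (λ x → ∃ λ j → P j x) xs → length xs ≤ ∑[ j < k ] length (filter (P? j) xs)
length≤∑filter P? [] [] = z≤n
length≤∑filter {k = suc k} P? (x ∷ xs) ((j , Pjx) ∷ covered) = begin
  1 + length xs
    ≤⟨ +-mono-≤ (subst (_≤ ∑[ j' < suc k ] indicator j') (cong bit (dec-true (P? j x) Pjx)) term≤∑)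
                (length≤∑filter P? xs covered) ⟩
  ∑[ j' < suc k ] indicator j' + ∑[ j' < suc k ] length (filter (P? j') xs)
    ≡⟨ ∑-distrib-+ indicator (λ j' → length (filter (P? j') xs)) ⟨
  ∑[ j' < suc k ] (indicator j' + length (filter (P? j') xs))
    ≡⟨ sum-cong-≗ (λ j' → length-filter-∷ (P? j') x xs) ⟨
  ∑[ j' < suc k ] length (filter (P? j') (x ∷ xs)) ∎
  where
  open ≤-Reasoning
  indicator : Fin (suc k) → ℕ
  indicator j' = bit (does (P? j' x))
  term≤∑ : indicator j ≤ ∑[ j' < suc k ] indicator j'
  term≤∑ = ≤-trans (m≤m+n _ _) (≤-reflexive (sym (sum-remove {i = j} indicator)))

module FocalFree (d : ℕ) {n} (F : Family n) where

  open ResidueClasses d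

  offClass : Fin R → ℕ → Bool
  offClass j = not ∘′ inClass (toℕ j)

  Neighbour : Fin R → BVec n → BVec n → Set
  Neighbour j x y = y ≢ x × Agree (offClass j) x y

  neighbour? : ∀ j x → Dec (Any (Neighbour j x) F)
  neighbour? j x = Any.any? (λ y → ¬? (y ≟ᵛ x) ×-dec agree? (offClass j) x y) F

  Isolated : Fin R → BVec n → Set
  Isolated j x = ¬ Any (Neighbour j x) F

  isolated? : ∀ j x → Dec (Isolated j x)
  isolated? j x = ¬? (neighbour? j x)

  neighbours⇒focal : ∀ {x} → x ∈ F → (∀ j → Any (Neighbour j x) F) → ContainsFocal (suc R) F
  neighbours⇒focal {x} x∈F neighbours =
    x , tabulate w , x∈F ∷ All.tabulate⁺ (λ j → proj₁ (proj₂ (chosen j))) , near⇒focal unique (length-tabulate w) near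
    where
    chosen : ∀ j → ∃ λ y → y ∈ F × Neighbour j x y
    chosen j = find (neighbours j)
    w : Fin R → BVec n
    w j = proj₁ (chosen j)
    w≢x : ∀ j → w j ≢ x
    w≢x j = proj₁ (proj₂ (proj₂ (chosen j)))
    differs⇒inClass : ∀ j i → lookup (w j) i ≢ lookup x i → toℕ i % R ≡ toℕ j
    differs⇒inClass j i differs with toℕ i % R ≟ toℕ j
    ... | yes inClass-j = inClass-j
    ... | no offClass-j = contradiction (sym (proj₂ (proj₂ (proj₂ (chosen j))) i (fromWitnessFalse offClass-j))) differs
    injective : ∀ {j j'} → w j ≡ w j' → j ≡ j'
    injective {j} {j'} wj≡wj' with ≢⇒∃lookup≢ (w≢x j)
    ... | i , differs = toℕ-injective (trans (sym (differs⇒inClass j i differs))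
                          (differs⇒inClass j' i (subst (λ y → lookup y i ≢ lookup x i) wj≡wj' differs)))
    unique : Unique (x ∷ tabulate w)
    unique = All.tabulate⁺ (λ j x≡wj → w≢x j (sym x≡wj)) ∷ Unique.tabulate⁺ injective
    near : ∀ i → Near (lookup x i) (column i (tabulate w))
    near i = subst (Near (lookup x i)) (sym (map-tabulate w (λ y → lookup y i)))
      (no-two-deviate⇒near (AllPairs.tabulate⁺ atMostOneDiffers))
      where
      atMostOneDiffers : ∀ {j j'} → j ≢ j' → lookup (w j) i ≡ lookup x i ⊎ lookup (w j') i ≡ lookup x i
      atMostOneDiffers {j} {j'} j≢j' with lookup (w j) i Bool.≟ lookup x i | lookup (w j') i Bool.≟ lookup x i
      ... | yes same | _ = inj₁ same
      ... | no _ | yes same = inj₂ same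
      ... | no differs | no differs' =
        contradiction (toℕ-injective (trans (sym (differs⇒inClass j i differs)) (differs⇒inClass j' i differs'))) j≢j'

  focalFree⇒isolated : ¬ ContainsFocal (suc R) F → ∀ {x} → x ∈ F → ∃ λ j → Isolated j x
  focalFree⇒isolated noFocal {x} x∈F with any? (λ j → isolated? j x)
  ... | yes isolated = isolated
  ... | no nowhere = contradiction
    (neighbours⇒focal x∈F λ j → decidable-stable (neighbour? j x) (λ none → nowhere (j , none))) noFocal

  isolated-separated : Unique F → ∀ j → Separated (offClass j) (filter (isolated? j) F)
  isolated-separated unique j = allPairs-map-with-∈ (Unique.filter⁺ (isolated? j) unique) separate
    where
    separate : ∀ {x y} → x ∈ filter (isolated? j) F → y ∈ filter (isolated? j) F → x ≢ y → ¬ Agree (offClass j) x y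
    separate x∈ y∈ x≢y agree = proj₂ (∈-filter⁻ (isolated? j) {xs = F} x∈)
      (lose (proj₁ (∈-filter⁻ (isolated? j) {xs = F} y∈)) ((λ y≡x → x≢y (sym y≡x)) , agree))

  focalFree⇒length≤ : FFFree n (suc R) F → length F ≤ R * 2 ^ ((d * n + d) / R)
  focalFree⇒length≤ (unique , noFocal) = begin
    length F
      ≤⟨ length≤∑filter isolated? F (All.tabulate (focalFree⇒isolated noFocal)) ⟩
    ∑[ j < R ] length (filter (isolated? j) F)
      ≤⟨ ∑-bound _ isolatedBound ⟩
    R * 2 ^ ((d * n + d) / R) ∎
    where
    open ≤-Reasoning
    isolatedBound : ∀ j → length (filter (isolated? j) F) ≤ 2 ^ ((d * n + d) / R)
    isolatedBound j = ≤-trans (separated⇒length≤ (offClass j) _ (isolated-separated unique j))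
                              (^-monoʳ-≤ 2 (count-offClass≤ (toℕ<n j) n))

gff-upper : ∀ {d n b} → IsGff (suc (suc d)) n b → b ≤ suc d * 2 ^ ceilDiv (d * n) (suc d)
gff-upper {d} ((G , free , refl) , _) = FocalFree.focalFree⇒length≤ d G free

-- Random subfamilies

-- A subfamily of {0,1}^n, stored as the truth table of its indicator function.
Subfamily : ℕ → Set
Subfamily zero = Bool
Subfamily (suc n) = Subfamily n × Subfamily n

member : ∀ {n} → Subfamily n → BVec n → Bool
member {zero} b [] = b
member {suc n} (S₀ , S₁) (false ∷ v) = member S₀ v
member {suc n} (S₀ , S₁) (true ∷ v) = member S₁ v

size : ∀ {n} → Subfamily n → ℕ
size {zero} b = bit b
size {suc n} (S₀ , S₁) = size S₀ + size S₁

members : ∀ {n} → Subfamily n → Family n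
members {zero} b = if b then [] ∷ [] else []
members {suc n} (S₀ , S₁) = map (false ∷_) (members S₀) ++ map (true ∷_) (members S₁)

length-members : ∀ {n} (S : Subfamily n) → length (members S) ≡ size S
length-members {zero} true = refl
length-members {zero} false = refl
length-members {suc n} (S₀ , S₁) = begin
  length (map (false ∷_) (members S₀) ++ map (true ∷_) (members S₁))
    ≡⟨ length-++ (map (false ∷_) (members S₀)) ⟩
  length (map (false ∷_) (members S₀)) + length (map (true ∷_) (members S₁))
    ≡⟨ cong₂ _+_ (length-map _ (members S₀)) (length-map _ (members S₁)) ⟩
  length (members S₀) + length (members S₁)
    ≡⟨ cong₂ _+_ (length-members S₀) (length-members S₁) ⟩
  size S₀ + size S₁ ∎
  where open ≡-Reasoning

members-unique : ∀ {n} (S : Subfamily n) → Unique (members S)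
members-unique {zero} true = [] ∷ []
members-unique {zero} false = []
members-unique {suc n} (S₀ , S₁) =
  Unique.++⁺ (Unique.map⁺ Vec.∷-injectiveʳ (members-unique S₀)) (Unique.map⁺ Vec.∷-injectiveʳ (members-unique S₁))
             disjoint
  where
  disjoint : ∀ {v} → v ∈ map (false ∷_) (members S₀) × v ∈ map (true ∷_) (members S₁) → ⊥
  disjoint (v∈₀ , v∈₁) with ∈-map⁻ (false ∷_) v∈₀ | ∈-map⁻ (true ∷_) v∈₁
  ... | _ , _ , refl | _ , _ , ()

∈-members⁻ : ∀ {n} (S : Subfamily n) {v} → v ∈ members S → T (member S v)
∈-members⁻ {zero} true (here refl) = tt
∈-members⁻ {suc n} (S₀ , S₁) v∈ with ∈-++⁻ (map (false ∷_) (members S₀)) v∈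
... | inj₁ v∈₀ with ∈-map⁻ (false ∷_) v∈₀
...   | _ , u∈ , refl = ∈-members⁻ S₀ u∈
∈-members⁻ {suc n} (S₀ , S₁) v∈ | inj₂ v∈₁ with ∈-map⁻ (true ∷_) v∈₁
...   | _ , u∈ , refl = ∈-members⁻ S₁ u∈

all-slices : ∀ {n} (S₀ S₁ : Subfamily n) L →
             all (member (S₀ , S₁)) L ≡ all (member S₀) (slice false L) ∧ all (member S₁) (slice true L)
all-slices S₀ S₁ [] = refl
all-slices S₀ S₁ ((false ∷ v) ∷ L) rewrite all-slices S₀ S₁ L = sym (Bool.∧-assoc (member S₀ v) _ _)
all-slices S₀ S₁ ((true ∷ v) ∷ L) rewrite all-slices S₀ S₁ L with member S₁ v
... | true = refl
... | false = sym (Bool.∧-zeroʳ _)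

remove : ∀ {n} → BVec n → Subfamily n → Subfamily n
remove [] _ = false
remove (false ∷ v) (S₀ , S₁) = remove v S₀ , S₁
remove (true ∷ v) (S₀ , S₁) = S₀ , remove v S₁

size≤1+size-remove : ∀ {n} (x : BVec n) S → size S ≤ suc (size (remove x S))
size≤1+size-remove [] b = bit≤1 b
size≤1+size-remove (false ∷ v) (S₀ , S₁) = +-monoˡ-≤ (size S₁) (size≤1+size-remove v S₀)
size≤1+size-remove (true ∷ v) (S₀ , S₁) =
  ≤-trans (+-monoʳ-≤ (size S₀) (size≤1+size-remove v S₁)) (≤-reflexive (+-suc (size S₀) _))

member-remove-self : ∀ {n} (x : BVec n) S → ¬ T (member (remove x S) x)
member-remove-self [] _ ()
member-remove-self (false ∷ v) (S₀ , _) = member-remove-self v S₀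
member-remove-self (true ∷ v) (_ , S₁) = member-remove-self v S₁

member-remove : ∀ {n} (x : BVec n) S {y} → T (member (remove x S) y) → T (member S y)
member-remove [] _ {[]} ()
member-remove (false ∷ v) (S₀ , _) {false ∷ u} = member-remove v S₀
member-remove (false ∷ v) _ {true ∷ u} = id
member-remove (true ∷ v) _ {false ∷ u} = id
member-remove (true ∷ v) (_ , S₁) {true ∷ u} = member-remove v S₁

prune : ∀ {n} → List (Family n) → Subfamily n → Subfamily n
prune [] S = S
prune ([] ∷ B) S = prune B S
prune ((x ∷ _) ∷ B) S = remove x (prune B S)

size≤size-prune+length : ∀ {n} (B : List (Family n)) S → size S ≤ size (prune B S) + length B
size≤size-prune+length [] S = m≤m+n (size S) 0
size≤size-prune+length ([] ∷ B) S = ≤-trans (size≤size-prune+length B S) (+-monoʳ-≤ _ (n≤1+n (length B)))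
size≤size-prune+length ((x ∷ _) ∷ B) S = begin
  size S                                       ≤⟨ size≤size-prune+length B S ⟩
  size (prune B S) + length B                  ≤⟨ +-monoˡ-≤ (length B) (size≤1+size-remove x (prune B S)) ⟩
  suc (size (remove x (prune B S))) + length B ≡⟨ +-suc _ (length B) ⟨
  size (remove x (prune B S)) + suc (length B) ∎
  where open ≤-Reasoning

member-prune : ∀ {n} (B : List (Family n)) S {y} → T (member (prune B S) y) → T (member S y)
member-prune [] S = id
member-prune ([] ∷ B) S = member-prune B S
member-prune ((x ∷ _) ∷ B) S = member-prune B S ∘′ member-remove x (prune B S)

prune-removes-heads : ∀ {n} {B : List (Family n)} S {x xs} → (x ∷ xs) ∈ B → ¬ T (member (prune B S) x)
prune-removes-heads {B = (x ∷ _) ∷ B} S (here refl) = member-remove-self x (prune B S)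
prune-removes-heads {B = [] ∷ B} S (there x∷xs∈B) = prune-removes-heads S x∷xs∈B
prune-removes-heads {B = (y ∷ _) ∷ B} S (there x∷xs∈B) = prune-removes-heads S x∷xs∈B ∘′ member-remove y (prune B S)

Distinct : ∀ {n} → ℕ → Family n → Set
Distinct r L = Unique L × length L ≡ r

contained : ∀ {n} → List (Family n) → Subfamily n → List (Family n)
contained A S = filterᵇ (all (member S)) A

pruned-avoids : ∀ {n R} {A : List (Family n)} → All (Distinct (suc R)) A → ∀ S →
                ∀ {L} → L ∈ A → ¬ L ⊆F members (prune (contained A S) S)
pruned-avoids distinct S {[]} []∈A _ = 0≢1+n (proj₂ (All.lookup distinct []∈A))
pruned-avoids {A = A} distinct S {x ∷ xs} L∈A L⊆F@(x∈F ∷ _) =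
  prune-removes-heads S L∈B (∈-members⁻ (prune B S) x∈F)
  where
  B = contained A S
  L∈B : (x ∷ xs) ∈ B
  L∈B = ∈-filter⁺ (λ L' → T? (all (member S) L')) L∈A
          (All.all⁻ (member S) (All.map (λ t∈F → member-prune B S (∈-members⁻ (prune B S) t∈F)) L⊆F))

-- wsum n f sums f S · m ^ (number of vectors missing from S) over all subfamilies S, that is
-- (m + 1) ^ (2 ^ n) times the expectation of f when each vector is kept with probability 1/(m + 1).
module Weighted (m : ℕ) where

  M : ℕ
  M = suc m

  wsum : ∀ n → (Subfamily n → ℕ) → ℕ
  wsum zero f = f true + m * f false
  wsum (suc n) f = wsum n λ S₀ → wsum n λ S₁ → f (S₀ , S₁)

  total : ℕ → ℕ
  total n = wsum n (λ _ → 1)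

  wsum-cong : ∀ n {f g : Subfamily n → ℕ} → (∀ S → f S ≡ g S) → wsum n f ≡ wsum n g
  wsum-cong zero f≗g = cong₂ (λ a b → a + m * b) (f≗g true) (f≗g false)
  wsum-cong (suc n) f≗g = wsum-cong n λ S₀ → wsum-cong n λ S₁ → f≗g (S₀ , S₁)

  wsum-+ : ∀ n (f g : Subfamily n → ℕ) → wsum n (λ S → f S + g S) ≡ wsum n f + wsum n g
  wsum-+ zero f g = solve 5 (λ a b c d m → (a :+ b) :+ m :* (c :+ d) := (a :+ m :* c) :+ (b :+ m :* d))
                      refl (f true) (g true) (f false) (g false) m
  wsum-+ (suc n) f g =
    trans (wsum-cong n λ S₀ → wsum-+ n (λ S₁ → f (S₀ , S₁)) (λ S₁ → g (S₀ , S₁))) (wsum-+ n _ _)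

  wsum-*ˡ : ∀ n c (f : Subfamily n → ℕ) → wsum n (λ S → c * f S) ≡ c * wsum n f
  wsum-*ˡ zero c f = solve 4 (λ c a b m → c :* a :+ m :* (c :* b) := c :* (a :+ m :* b)) refl c (f true) (f false) m
  wsum-*ˡ (suc n) c f = trans (wsum-cong n λ S₀ → wsum-*ˡ n c (λ S₁ → f (S₀ , S₁))) (wsum-*ˡ n c _)

  wsum-const : ∀ n c → wsum n (λ _ → c) ≡ c * total n
  wsum-const n c = trans (wsum-cong n λ _ → sym (*-identityʳ c)) (wsum-*ˡ n c (λ _ → 1))

  wsum-product : ∀ n (f g : Subfamily n → ℕ) → wsum (suc n) (λ S → f (proj₁ S) * g (proj₂ S)) ≡ wsum n f * wsum n g
  wsum-product n f g = begin
    wsum n (λ S₀ → wsum n λ S₁ → f S₀ * g S₁)   ≡⟨ wsum-cong n (λ S₀ → wsum-*ˡ n (f S₀) g) ⟩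
    wsum n (λ S₀ → f S₀ * wsum n g)              ≡⟨ wsum-cong n (λ S₀ → *-comm (f S₀) (wsum n g)) ⟩
    wsum n (λ S₀ → wsum n g * f S₀)              ≡⟨ wsum-*ˡ n (wsum n g) f ⟩
    wsum n g * wsum n f                           ≡⟨ *-comm (wsum n g) (wsum n f) ⟩
    wsum n f * wsum n g                           ∎
    where open ≡-Reasoning

  total-suc : ∀ n → total (suc n) ≡ total n * total n
  total-suc n = wsum-product n (λ _ → 1) (λ _ → 1)

  averaging : ∀ n {f g : Subfamily n → ℕ} → wsum n f ≤ wsum n g → ∃ λ S → f S ≤ g S
  averaging zero {f} {g} Σf≤Σg with f true ≤? g true | f false ≤? g false
  ... | yes ≤-at-true | _ = true , ≤-at-true
  ... | no _ | yes ≤-at-false = false , ≤-at-false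
  ... | no >-at-true | no >-at-false =
    contradiction Σf≤Σg (<⇒≱ (+-mono-<-≤ (≰⇒> >-at-true) (*-monoʳ-≤ m (<⇒≤ (≰⇒> >-at-false)))))
  averaging (suc n) Σf≤Σg with averaging n Σf≤Σg
  ... | S₀ , inner with averaging n inner
  ...   | S₁ , f≤g = (S₀ , S₁) , f≤g

  wsum-size : ∀ n → M * wsum n size ≡ 2 ^ n * total n
  wsum-size zero = solve 1 (λ m → (con 1 :+ m) :* (con 1 :+ m :* con 0) := con 1 :* (con 1 :+ m :* con 1)) refl m
  wsum-size (suc n) = begin
    M * wsum (suc n) (λ S → size (proj₁ S) + size (proj₂ S))
      ≡⟨ cong (M *_) (trans (wsum-cong (suc n) λ (S₀ , S₁) →
                                cong₂ _+_ (sym (*-identityʳ (size S₀))) (sym (*-identityˡ (size S₁))))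
                            (wsum-+ (suc n) _ _)) ⟩
    M * (wsum (suc n) (λ S → size (proj₁ S) * 1) + wsum (suc n) (λ S → 1 * size (proj₂ S)))
      ≡⟨ cong (M *_) (cong₂ _+_ (wsum-product n size (λ _ → 1)) (wsum-product n (λ _ → 1) size)) ⟩
    M * (s * z + z * s)
      ≡⟨ solve 3 (λ M s z → M :* (s :* z :+ z :* s) := con 2 :* (M :* s) :* z) refl M s z ⟩
    2 * (M * s) * z
      ≡⟨ cong (λ x → 2 * x * z) (wsum-size n) ⟩
    2 * (2 ^ n * z) * z
      ≡⟨ solve 2 (λ p z → con 2 :* (p :* z) :* z := (con 2 :* p) :* (z :* z)) refl (2 ^ n) z ⟩
    2 ^ suc n * (z * z)
      ≡⟨ cong (2 ^ suc n *_) (total-suc n) ⟨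
    2 ^ suc n * total (suc n) ∎
    where
    open ≡-Reasoning
    s = wsum n size
    z = total n

  wsum-⊆ : ∀ n (L : Family n) → Unique L → M ^ length L * wsum n (λ S → bit (all (member S) L)) ≡ total n
  wsum-⊆ zero [] _ = *-identityˡ (total 0)
  wsum-⊆ zero ([] ∷ []) _ = solve 1 (λ m → (con 1 :+ m) :* con 1 :* (con 1 :+ m :* con 0) := con 1 :+ m :* con 1) refl m
  wsum-⊆ zero ([] ∷ [] ∷ _) (([]≢[] ∷ _) ∷ _) = contradiction refl []≢[]
  wsum-⊆ (suc n) L unique = begin
    M ^ length L * wsum (suc n) (λ S → bit (all (member S) L))
      ≡⟨ cong₂ _*_ (trans (cong (M ^_) (length-slices L)) (^-distribˡ-+-* M (length L₀) (length L₁)))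
                   (trans (wsum-cong (suc n) λ (S₀ , S₁) →
                                 trans (cong bit (all-slices S₀ S₁ L)) (bit-∧ (all (member S₀) L₀) (all (member S₁) L₁)))
                          (wsum-product n (λ S₀ → bit (all (member S₀) L₀)) (λ S₁ → bit (all (member S₁) L₁)))) ⟩
    (M ^ length L₀ * M ^ length L₁) * (W L₀ * W L₁)
      ≡⟨ solve 4 (λ a b c d → (a :* b) :* (c :* d) := (a :* c) :* (b :* d))
                 refl (M ^ length L₀) (M ^ length L₁) (W L₀) (W L₁) ⟩
    (M ^ length L₀ * W L₀) * (M ^ length L₁ * W L₁)
      ≡⟨ cong₂ _*_ (wsum-⊆ n L₀ (slice-unique⁺ false unique)) (wsum-⊆ n L₁ (slice-unique⁺ true unique)) ⟩
    total n * total n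
      ≡⟨ total-suc n ⟨
    total (suc n) ∎
    where
    open ≡-Reasoning
    L₀ = slice false L
    L₁ = slice true L
    W : Family n → ℕ
    W L' = wsum n (λ S → bit (all (member S) L'))

  wsum-contained : ∀ n {r} (A : List (Family n)) → All (Distinct r) A →
                   M ^ r * wsum n (λ S → length (contained A S)) ≡ length A * total n
  wsum-contained n {r} [] [] = trans (cong (M ^ r *_) (wsum-const n 0)) (*-zeroʳ (M ^ r))
  wsum-contained n (L ∷ A) ((unique , refl) ∷ distinct) = begin
    M ^ length L * wsum n (λ S → length (contained (L ∷ A) S))
      ≡⟨ cong (M ^ length L *_) (trans (wsum-cong n λ S → length-filter-∷ (λ L' → T? (all (member S) L')) L A)
                                       (wsum-+ n (λ S → bit (all (member S) L)) (λ S → length (contained A S)))) ⟩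
    M ^ length L * (wsum n (λ S → bit (all (member S) L)) + wsum n (λ S → length (contained A S)))
      ≡⟨ *-distribˡ-+ (M ^ length L) _ _ ⟩
    M ^ length L * wsum n (λ S → bit (all (member S) L)) + M ^ length L * wsum n (λ S → length (contained A S))
      ≡⟨ cong₂ _+_ (wsum-⊆ n L unique) (wsum-contained n A distinct) ⟩
    total n + length A * total n ∎
    where open ≡-Reasoning

  wsum-c+contained≤wsum-size : ∀ {n R} (A : List (Family n)) → All (Distinct (suc R)) A → ∀ c →
                               length A + c * M ^ suc R ≤ M ^ R * 2 ^ n →
                               wsum n (λ S → c + length (contained A S)) ≤ wsum n size
  wsum-c+contained≤wsum-size {n} {R} A distinct c few = *-cancelˡ-≤ (M ^ suc R) {{m^n≢0 M (suc R)}} (begin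
    M ^ suc R * wsum n (λ S → c + bad S)
      ≡⟨ cong (M ^ suc R *_) (wsum-+ n (λ _ → c) bad) ⟩
    M ^ suc R * (wsum n (λ _ → c) + wsum n bad)
      ≡⟨ *-distribˡ-+ (M ^ suc R) _ _ ⟩
    M ^ suc R * wsum n (λ _ → c) + M ^ suc R * wsum n bad
      ≡⟨ cong₂ _+_ (cong (M ^ suc R *_) (wsum-const n c)) (wsum-contained n A distinct) ⟩
    M ^ suc R * (c * total n) + length A * total n
      ≡⟨ solve 4 (λ p c z a → p :* (c :* z) :+ a :* z := (a :+ c :* p) :* z) refl (M ^ suc R) c (total n) (length A) ⟩
    (length A + c * M ^ suc R) * total n
      ≤⟨ *-monoˡ-≤ (total n) few ⟩
    M ^ R * 2 ^ n * total n
      ≡⟨ *-assoc (M ^ R) (2 ^ n) (total n) ⟩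
    M ^ R * (2 ^ n * total n)
      ≡⟨ cong (M ^ R *_) (wsum-size n) ⟨
    M ^ R * (M * wsum n size)
      ≡⟨ solve 3 (λ p M s → p :* (M :* s) := (M :* p) :* s) refl (M ^ R) M (wsum n size) ⟩
    M ^ suc R * wsum n size ∎)
    where
    open ≤-Reasoning
    bad : Subfamily n → ℕ
    bad S = length (contained A S)

avoiding-family : ∀ {n R} (A : List (Family n)) → All (Distinct (suc R)) A →
                  ∀ m c → length A + c * suc m ^ suc R ≤ suc m ^ R * 2 ^ n →
                  ∃ λ F → Unique F × (∀ {L} → L ∈ A → ¬ L ⊆F F) × c ≤ length F
avoiding-family {n} A distinct m c few =
  let S , c+bad≤size = Weighted.averaging m n (Weighted.wsum-c+contained≤wsum-size m A distinct c few)
      B = contained A S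
  in members (prune B S) , members-unique (prune B S) , pruned-avoids distinct S ,
     +-cancelʳ-≤ (length B) c _ (begin
       c + length B                             ≤⟨ c+bad≤size ⟩
       size S                                   ≤⟨ size≤size-prune+length B S ⟩
       size (prune B S) + length B              ≡⟨ cong (_+ length B) (length-members (prune B S)) ⟨
       length (members (prune B S)) + length B  ∎)
  where open ≤-Reasoning

-- Configurations with prescribed columns

nearConst : ℕ → Bool → List (List Bool)
nearConst zero b = [] ∷ []
nearConst (suc k) b = (not b ∷ List.replicate k b) ∷ map (b ∷_) (nearConst k b)

length-nearConst : ∀ k b → length (nearConst k b) ≡ suc k
length-nearConst zero b = refl
length-nearConst (suc k) b = cong suc (trans (length-map (b ∷_) (nearConst k b)) (length-nearConst k b))

deviations≡0⇒≡replicate : ∀ {b} c → deviations b c ≡ 0 → c ≡ List.replicate (length c) b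
deviations≡0⇒≡replicate [] _ = refl
deviations≡0⇒≡replicate {false} (false ∷ c) none = cong (false ∷_) (deviations≡0⇒≡replicate c none)
deviations≡0⇒≡replicate {true} (true ∷ c) none = cong (true ∷_) (deviations≡0⇒≡replicate c none)

∈-nearConst : ∀ {b} c → Near b c → c ∈ nearConst (length c) b
∈-nearConst [] _ = here refl
∈-nearConst {false} (false ∷ c) near = there (∈-map⁺ (false ∷_) (∈-nearConst c near))
∈-nearConst {true} (true ∷ c) near = there (∈-map⁺ (true ∷_) (∈-nearConst c near))
∈-nearConst {false} (true ∷ c) (s≤s none) = here (cong (true ∷_) (deviations≡0⇒≡replicate c (n≤0⇒n≡0 none)))
∈-nearConst {true} (false ∷ c) (s≤s none) = here (cong (false ∷_) (deviations≡0⇒≡replicate c (n≤0⇒n≡0 none)))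

nsColumns : ℕ → List (List Bool)
nsColumns r = nearConst r false ++ nearConst r true

focalColumns : ℕ → List (List Bool)
focalColumns R = map (false ∷_) (nearConst R false) ++ map (true ∷_) (nearConst R true)

length-nsColumns : ∀ r → length (nsColumns r) ≡ (r + 1) + (r + 1)
length-nsColumns r = trans (length-++ (nearConst r false))
  (cong₂ _+_ (trans (length-nearConst r false) (+-comm 1 r)) (trans (length-nearConst r true) (+-comm 1 r)))

length-focalColumns : ∀ R → length (focalColumns R) ≡ suc R + suc R
length-focalColumns R = trans (length-++ (map (false ∷_) (nearConst R false)))
  (cong₂ _+_ (trans (length-map _ (nearConst R false)) (length-nearConst R false))
             (trans (length-map _ (nearConst R true)) (length-nearConst R true)))

nearConstant∈nsColumns : ∀ {r} c → length c ≡ r → NearConstant c → c ∈ nsColumns r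
nearConstant∈nsColumns c refl (inj₁ near) = ∈-++⁺ˡ (∈-nearConst c near)
nearConstant∈nsColumns c refl (inj₂ near) = ∈-++⁺ʳ (nearConst (length c) false) (∈-nearConst c near)

near∈focalColumns : ∀ {R} b c → length c ≡ R → Near b c → (b ∷ c) ∈ focalColumns R
near∈focalColumns false c refl near = ∈-++⁺ˡ (∈-map⁺ (false ∷_) (∈-nearConst c near))
near∈focalColumns true c refl near =
  ∈-++⁺ʳ (map (false ∷_) (nearConst (length c) false)) (∈-map⁺ (true ∷_) (∈-nearConst c near))

withColumns : ℕ → List (List Bool) → (n : ℕ) → List (Family n)
withColumns r C zero = List.replicate r [] ∷ []
withColumns r C (suc n) = cartesianProductWith (zipWith _∷_) C (withColumns r C n)

length-cartesianProductWith : ∀ {A B C : Set} (f : A → B → C) xs ys →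
                              length (cartesianProductWith f xs ys) ≡ length xs * length ys
length-cartesianProductWith f [] ys = refl
length-cartesianProductWith f (x ∷ xs) ys =
  trans (length-++ (map (f x) ys)) (cong₂ _+_ (length-map (f x) ys) (length-cartesianProductWith f xs ys))

length-withColumns : ∀ r C n → length (withColumns r C n) ≡ length C ^ n
length-withColumns r C zero = refl
length-withColumns r C (suc n) =
  trans (length-cartesianProductWith (zipWith _∷_) C (withColumns r C n)) (cong (length C *_) (length-withColumns r C n))

family₀≡replicate : (L : Family 0) → L ≡ List.replicate (length L) []
family₀≡replicate [] = refl
family₀≡replicate ([] ∷ L) = cong ([] ∷_) (family₀≡replicate L)

family≡zip-columns : ∀ {n} (L : Family (suc n)) → L ≡ zipWith _∷_ (column fzero L) (map tail L)
family≡zip-columns [] = refl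
family≡zip-columns ((b ∷ v) ∷ L) = cong ((b ∷ v) ∷_) (family≡zip-columns L)

column-map-tail : ∀ {n} (i : Fin n) (L : Family (suc n)) → column i (map tail L) ≡ column (fsuc i) L
column-map-tail i [] = refl
column-map-tail i ((b ∷ v) ∷ L) = cong (lookup v i ∷_) (column-map-tail i L)

∈-withColumns : ∀ {r C} n (L : Family n) → length L ≡ r → (∀ i → column i L ∈ C) → L ∈ withColumns r C n
∈-withColumns zero L refl _ = here (family₀≡replicate L)
∈-withColumns {r} {C} (suc n) L length≡r columns∈C = subst (_∈ withColumns r C (suc n)) (sym (family≡zip-columns L))
  (∈-cartesianProductWith⁺ (zipWith _∷_) (columns∈C fzero)
    (∈-withColumns n (map tail L) (trans (length-map tail L) length≡r)
      (λ i → subst (_∈ C) (sym (column-map-tail i L)) (columns∈C (fsuc i)))))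

distinct? : ∀ {n} r (L : Family n) → Dec (Distinct r L)
distinct? r L = AllPairs.allPairs? (λ x y → ¬? (x ≟ᵛ y)) L ×-dec (length L ≟ r)

configurations : ℕ → List (List Bool) → (n : ℕ) → List (Family n)
configurations r C n = filter (distinct? r) (withColumns r C n)

length-configurations≤ : ∀ r C n → length (configurations r C n) ≤ length C ^ n
length-configurations≤ r C n =
  ≤-trans (length-filter (distinct? r) (withColumns r C n)) (≤-reflexive (length-withColumns r C n))

∈-configurations : ∀ {r C n} {L : Family n} → Distinct r L → (∀ i → column i L ∈ C) → L ∈ configurations r C n
∈-configurations {n = n} {L} distinct@(_ , length≡r) columns∈C =
  ∈-filter⁺ (distinct? _) (∈-withColumns n L length≡r columns∈C) distinct

nearSunflower∈configurations : ∀ {n r} {H : Family n} → NearSunflower r H → H ∈ configurations r (nsColumns r) n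
nearSunflower∈configurations {H = H} sunflower@(unique , length≡r , _) = ∈-configurations (unique , length≡r)
  λ i → nearConstant∈nsColumns (column i H) (trans (length-map _ H) length≡r) (nearSunflower⇒nearConstant sunflower i)

focal∈configurations : ∀ {n R} {x₀ : BVec n} {xs} → Focal (suc R) x₀ xs →
                       (x₀ ∷ xs) ∈ configurations (suc R) (focalColumns R) n
focal∈configurations {x₀ = x₀} {xs} focal@(unique , length≡r , _) = ∈-configurations (unique , length≡r)
  λ i → near∈focalColumns (lookup x₀ i) (column i xs) (trans (length-map _ xs) (suc-injective length≡r))
                          (focal⇒near focal i)

-- Lower bounds

deletion-bound : ∀ {n R a} C {Free : Family n → Set} →
                 (∀ {F} → Unique F → (∀ {L} → L ∈ configurations (suc R) C n → ¬ L ⊆F F) → Free F) →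
                 IsMaxSize Free a → ∀ c m → length C ^ n + c * suc m ^ suc R ≤ suc m ^ R * 2 ^ n → c ≤ a
deletion-bound {n} {R} C avoids⇒free (_ , maximal) c m few =
  let F , unique , avoids , c≤length = avoiding in ≤-trans c≤length (maximal F (avoids⇒free unique avoids))
  where
  avoiding : ∃ λ F → Unique F × (∀ {L} → L ∈ configurations (suc R) C n → ¬ L ⊆F F) × c ≤ length F
  avoiding = avoiding-family (configurations (suc R) C n) (All.all-filter (distinct? (suc R)) (withColumns (suc R) C n)) m c
    (≤-trans (+-monoˡ-≤ (c * suc m ^ suc R) (length-configurations≤ (suc R) C n)) few)

^-distribʳ-* : ∀ a b e → (a * b) ^ e ≡ a ^ e * b ^ e
^-distribʳ-* a b zero = refl
^-distribʳ-* a b (suc e) = trans (cong (a * b *_) (^-distribʳ-* a b e))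
  (solve 4 (λ a b x y → a :* b :* (x :* y) := a :* x :* (b :* y)) refl a b (a ^ e) (b ^ e))

-- M = 2 K ^ (⌊n / e⌋ + 1) overshoots M ^ e ≈ 2 K ^ n by at most the factor K ^ e, which only depends on r.
weight-choice : ∀ e n K .{{_ : NonZero e}} .{{_ : NonZero K}} →
                ∃ λ m → 2 * K ^ n ≤ suc m ^ e × suc m ^ e ≤ 2 ^ e * K ^ (e + n)
weight-choice e n K =
  pred (2 * K ^ t) , 2Kⁿ≤Mᵉ , ≤-trans (≤-reflexive Mᵉ≡) (*-monoʳ-≤ (2 ^ e) (^-monoʳ-≤ K te≤e+n))
  where
  t = suc (n / e)
  n≤te : n ≤ t * e
  n≤te = ≤-trans (≤-reflexive (m≡m%n+[m/n]*n n e)) (+-monoˡ-≤ (n / e * e) (<⇒≤ (m%n<n n e)))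
  te≤e+n : t * e ≤ e + n
  te≤e+n = +-monoʳ-≤ e (m/n*n≤m n e)
  instance
    2Kᵗ≢0 : NonZero (2 * K ^ t)
    2Kᵗ≢0 = m*n≢0 2 (K ^ t) {{_}} {{m^n≢0 K t}}
  Mᵉ≡ : suc (pred (2 * K ^ t)) ^ e ≡ 2 ^ e * K ^ (t * e)
  Mᵉ≡ = trans (cong (_^ e) (suc-pred (2 * K ^ t))) (trans (^-distribʳ-* 2 (K ^ t) e) (cong (2 ^ e *_) (^-*-assoc K t e)))
  2Kⁿ≤Mᵉ : 2 * K ^ n ≤ suc (pred (2 * K ^ t)) ^ e
  2Kⁿ≤Mᵉ = ≤-trans (*-mono-≤ (^-monoʳ-≤ 2 {1} {e} (>-nonZero⁻¹ e)) (^-monoʳ-≤ K n≤te))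
                   (≤-reflexive (sym Mᵉ≡))

-- With c = ⌊2 ^ n / 2M⌋ each of the two terms on the left is at most half of the right-hand side.
deletion-hypothesis : ∀ {e n K m} → 2 * K ^ n ≤ suc m ^ e →
                      (K + K) ^ n + 2 ^ n / (2 * suc m) * suc m ^ suc e ≤ suc m ^ e * 2 ^ n
deletion-hypothesis {e} {n} {K} {m} 2Kⁿ≤Mᵉ = *-cancelˡ-≤ 2 (begin
  2 * ((K + K) ^ n + c * M ^ suc e)
    ≡⟨ cong (λ x → 2 * (x + c * M ^ suc e))
            (trans (cong (λ x → (K + x) ^ n) (sym (+-identityʳ K))) (^-distribʳ-* 2 K n)) ⟩
  2 * (2 ^ n * K ^ n + c * (M * M ^ e))
    ≡⟨ solve 5 (λ p k c M q → con 2 :* (p :* k :+ c :* (M :* q)) := p :* (con 2 :* k) :+ c :* (con 2 :* M) :* q)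
               refl (2 ^ n) (K ^ n) c M (M ^ e) ⟩
  2 ^ n * (2 * K ^ n) + c * (2 * M) * M ^ e
    ≤⟨ +-mono-≤ (*-monoʳ-≤ (2 ^ n) 2Kⁿ≤Mᵉ) (*-monoˡ-≤ (M ^ e) (m/n*n≤m (2 ^ n) (2 * M))) ⟩
  2 ^ n * M ^ e + 2 ^ n * M ^ e
    ≡⟨ solve 2 (λ p q → p :* q :+ p :* q := con 2 :* (q :* p)) refl (2 ^ n) (M ^ e) ⟩
  2 * (M ^ e * 2 ^ n) ∎)
  where
  open ≤-Reasoning
  M = suc m
  c = 2 ^ n / (2 * M)

lower-bound-from-weight : ∀ {e n K g} m → 1 ≤ g → 2 ^ n / (2 * suc m) ≤ g →
                          suc m ^ e ≤ 2 ^ e * K ^ (e + n) → 2 ^ (e * n) ≤ (8 * K * g) ^ e * K ^ n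
lower-bound-from-weight {e} {n} {K} {g} m 1≤g c≤g Mᵉ≤ = begin
  2 ^ (e * n)                         ≡⟨ trans (^-*-assoc 2 n e) (cong (2 ^_) (*-comm n e)) ⟨
  (2 ^ n) ^ e                         ≤⟨ ^-monoˡ-≤ e 2ⁿ≤2g2M ⟩
  (2 * g * (2 * M)) ^ e
    ≡⟨ trans (cong (_^ e) (solve 2 (λ g M → con 2 :* g :* (con 2 :* M) := con 4 :* g :* M) refl g M))
             (^-distribʳ-* (4 * g) M e) ⟩
  (4 * g) ^ e * M ^ e                 ≤⟨ *-monoʳ-≤ ((4 * g) ^ e) Mᵉ≤ ⟩
  (4 * g) ^ e * (2 ^ e * K ^ (e + n)) ≡⟨ cong (λ x → (4 * g) ^ e * (2 ^ e * x)) (^-distribˡ-+-* K e n) ⟩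
  (4 * g) ^ e * (2 ^ e * (K ^ e * K ^ n))
    ≡⟨ solve 4 (λ a b c d → a :* (b :* (c :* d)) := a :* b :* c :* d) refl ((4 * g) ^ e) (2 ^ e) (K ^ e) (K ^ n) ⟩
  (4 * g) ^ e * 2 ^ e * K ^ e * K ^ n
    ≡⟨ cong (_* K ^ n) (trans (cong (_* K ^ e) (sym (^-distribʳ-* (4 * g) 2 e))) (sym (^-distribʳ-* (4 * g * 2) K e))) ⟩
  (4 * g * 2 * K) ^ e * K ^ n
    ≡⟨ cong (λ x → x ^ e * K ^ n) (solve 2 (λ g K → con 4 :* g :* con 2 :* K := con 8 :* K :* g) refl g K) ⟩
  (8 * K * g) ^ e * K ^ n ∎
  where
  open ≤-Reasoning
  M = suc m
  c = 2 ^ n / (2 * M)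
  2ⁿ≤2g2M : 2 ^ n ≤ 2 * g * (2 * M)
  2ⁿ≤2g2M = begin
    2 ^ n                         ≡⟨ m≡m%n+[m/n]*n (2 ^ n) (2 * M) ⟩
    2 ^ n % (2 * M) + c * (2 * M) ≤⟨ +-monoˡ-≤ (c * (2 * M)) (<⇒≤ (m%n<n (2 ^ n) (2 * M))) ⟩
    suc c * (2 * M)               ≤⟨ *-monoˡ-≤ (2 * M) (+-mono-≤ 1≤g (subst (c ≤_) (sym (+-identityʳ g)) c≤g)) ⟩
    2 * g * (2 * M)               ∎

lower-bound-from-deletion : ∀ {E n K g} → 1 ≤ K → 1 ≤ g →
  (∀ c m → (K + K) ^ n + c * suc m ^ suc (suc E) ≤ suc m ^ suc E * 2 ^ n → c ≤ g) →
  2 ^ (suc E * n) ≤ (8 * K * g) ^ suc E * K ^ n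
lower-bound-from-deletion {E} {n} {K} {g} 1≤K 1≤g deletion =
  let m , 2Kⁿ≤Mᵉ , Mᵉ≤ = weight-choice (suc E) n K {{_}} {{>-nonZero 1≤K}}
  in lower-bound-from-weight {suc E} {n} {K} {g} m 1≤g
       (deletion (2 ^ n / (2 * suc m)) m (deletion-hypothesis {suc E} {n} {K} {m} 2Kⁿ≤Mᵉ)) Mᵉ≤

unique⊆singleton⇒length≤1 : ∀ {A : Set} {v : A} {L} → Unique L → All (_∈ v ∷ []) L → length L ≤ 1
unique⊆singleton⇒length≤1 {L = []} _ _ = z≤n
unique⊆singleton⇒length≤1 {L = _ ∷ []} _ _ = s≤s z≤n
unique⊆singleton⇒length≤1 {L = _ ∷ _ ∷ _} ((x≢y ∷ _) ∷ _) (here refl ∷ here refl ∷ _) = contradiction refl x≢y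

singleton-nsFree : ∀ {n r} → 2 ≤ r → (v : BVec n) → NSFree n r (v ∷ [])
singleton-nsFree 2≤r v = [] ∷ [] , λ (_ , H⊆v , unique , length≡r , _) →
  <⇒≱ (≤-trans 2≤r (≤-reflexive (sym length≡r))) (unique⊆singleton⇒length≤1 unique H⊆v)

gns-lower : ∀ {E n a} → let r = suc (suc E) in IsGns r n a → 2 ^ (suc E * n) ≤ (8 * (r + 1) * a) ^ suc E * (r + 1) ^ n
gns-lower {E} {n} {a} gns@(_ , maximal) =
  lower-bound-from-deletion {E} {n} {r + 1} {a} (s≤s z≤n) (maximal _ (singleton-nsFree (s≤s (s≤s z≤n)) (replicate n false)))
    deletion
  where
  r = suc (suc E)
  avoids⇒nsFree : ∀ {F} → Unique F → (∀ {L} → L ∈ configurations r (nsColumns r) n → ¬ L ⊆F F) → NSFree n r F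
  avoids⇒nsFree unique avoids = unique , λ (H , H⊆F , sunflower) → avoids (nearSunflower∈configurations sunflower) H⊆F
  deletion : ∀ c m → ((r + 1) + (r + 1)) ^ n + c * suc m ^ r ≤ suc m ^ suc E * 2 ^ n → c ≤ a
  deletion c m = deletion-bound {R = suc E} (nsColumns r) avoids⇒nsFree gns c m
                   ∘′ subst (λ x → x ^ n + c * suc m ^ r ≤ suc m ^ suc E * 2 ^ n) (sym (length-nsColumns r))

gff-lower : ∀ {E n b} → let r = suc (suc E) in IsGff r n b → 2 ^ (suc E * n) ≤ (8 * r * b) ^ suc E * r ^ n
gff-lower {E} {n} {b} gff@(_ , maximal) =
  lower-bound-from-deletion {E} {n} {r} {b} (s≤s z≤n)
    (maximal _ (nsFree⇒ffFree (singleton-nsFree (s≤s (s≤s z≤n)) (replicate n false)))) deletion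
  where
  r = suc (suc E)
  avoids⇒ffFree : ∀ {F} → Unique F → (∀ {L} → L ∈ configurations r (focalColumns (suc E)) n → ¬ L ⊆F F) →
                  FFFree n r F
  avoids⇒ffFree unique avoids =
    unique , λ (x₀ , xs , x₀∷xs⊆F , focal) → avoids (focal∈configurations focal) x₀∷xs⊆F
  deletion : ∀ c m → (r + r) ^ n + c * suc m ^ r ≤ suc m ^ suc E * 2 ^ n → c ≤ b
  deletion c m = deletion-bound {R = suc E} (focalColumns (suc E)) avoids⇒ffFree gff c m
                   ∘′ subst (λ x → x ^ n + c * suc m ^ r ≤ suc m ^ suc E * 2 ^ n) (sym (length-focalColumns (suc E)))

1^e*x≡x : ∀ e x → 1 ^ e * x ≡ x
1^e*x≡x e x = trans (cong (_* x) (^-zeroˡ e)) (*-identityˡ x)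

theorem1 : (r : ℕ) → 3 ≤ r →
    (((n : ℕ) → 1 ≤ n → (a b : ℕ) → IsGns r n a → IsGff r n b →
        a ≤ b × b ≤ (r ∸ 1) * 2 ^ ceilDiv ((r ∸ 2) * n) (r ∸ 1))
    ×
    ((∃₂ λ p q → 0 < p × 0 < q ×
        ((n : ℕ) → 1 ≤ n → (a : ℕ) → IsGns r n a →
          p ^ (r ∸ 1) * 2 ^ ((r ∸ 1) * n) ≤ (q * a) ^ (r ∸ 1) * (r + 1) ^ n))
     ×
     (∃₂ λ p q → 0 < p × 0 < q ×
        ((n : ℕ) → 1 ≤ n → (b : ℕ) → IsGff r n b →
          p ^ (r ∸ 1) * 2 ^ ((r ∸ 1) * n) ≤ (q * b) ^ (r ∸ 1) * r ^ n))))
theorem1 r@(suc (suc (suc _))) (s≤s (s≤s (s≤s _))) =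
  (λ n _ a b gns gff → gns≤gff gns gff , gff-upper gff) ,
  (1 , 8 * (r + 1) , s≤s z≤n , s≤s z≤n , λ n _ a gns →
    subst (_≤ (8 * (r + 1) * a) ^ (r ∸ 1) * (r + 1) ^ n) (sym (1^e*x≡x (r ∸ 1) _)) (gns-lower gns)) ,
  (1 , 8 * r , s≤s z≤n , s≤s z≤n , λ n _ b gff →
    subst (_≤ (8 * r * b) ^ (r ∸ 1) * r ^ n) (sym (1^e*x≡x (r ∸ 1) _)) (gff-lower gff))
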